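{- Let $(\vec U,\le,{}^*,\vee,\wedge)$ be a universe of separations containing a separation system $(\vec S,\le,{}^*)$ with induced ordering and involution. Let $\vec r\in\vec S$ be nontrivial and nondegenerate, and assume $\{\overleftarrow r\}$ is associated with a leaf of some irredundant $S$-tree over some standard set $\mathcal F\subseteq 2^{\vec S}$ of stars. Let $\vec s_0\in\vec S$ with $\vec r\le\vec s_0$. Then the shifting map $f=f^{\vec r}_{\vec s_0}$ preserves the ordering $\le$ on $\vec S_{\ge\vec r}\setminus\{\overleftarrow r\}$, i.e. $\vec s\le\vec s'$ in this set implies $f(\vec s)\le f(\vec s')$.
   Context: A separation system is a poset $\vec S$ with an order-reversing involution ${}^*$; if an element is written $\vec s$, its image is $\overleftarrow s$; a separation is $s=\{\vec s,\overleftarrow s\}$, degenerate if $\vec s=\overleftarrow s$; $S$ is the set of separations. A universe is a separation system in which any two elements have a supremum $\vee$ and infimum $\wedge$. $\vec r$ is trivial in $\vec S$ if some $s\in S$ has $\vec r<\vec s$ and $\vec r<\overleftarrow s$. A star is a nonempty $\sigma\subseteq\vec S$ with $\vec r\le\overleftarrow s$ for all distinct $\vec r,\vec s\in\sigma$. $\mathcal F$ forces $\vec r$ if $\{\overleftarrow r\}\in\mathcal F$ or $r$ is degenerate; $\mathcal F$ is standard if it forces every trivial element. An $S$-tree $(T,\alpha)$ is a tree $T$ with at least one edge and $\alpha:\vec E(T)\to\vec S$ ($\vec E(T)$ the set of ordered pairs $(x,y)$ with $xy\in E(T)$) with $\alpha(y,x)=\alpha(x,y)^*$; it is over $\mathcal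 F$ if $\alpha(\{(x,t):xt\in E(T)\})\in\mathcal F$ for every node $t$ (this set is associated with $t$); irredundant if no node $t$ has distinct neighbours $t',t''$ with $\alpha(t',t)=\alpha(t'',t)$. $\vec S_{\ge\vec r}$ is the set of all orientations of those $s\in S$ having an orientation $\vec s\ge\vec r$. The shifting map $f^{\vec r}_{\vec s_0}:\vec S_{\ge\vec r}\to\vec U$ is defined by $f(\vec s)=\vec s\vee\vec s_0$ and $f(\overleftarrow s)=(\vec s\vee\vec s_0)^*$ for every $\vec s\ge\vec r$ in $\vec S_{\ge\vec r}\setminus\{\overleftarrow r\}$ (well defined as $\vec r$ is nontrivial). -}

module Defs where

open import Data.Nat using (ℕ)
open import Data.Fin using (Fin)
open import Data.List using (List; []; _∷_; last)
open import Data.Maybe using (just)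
open import Data.List.Relation.Unary.Linked using (Linked)
open import Data.List.Relation.Unary.Unique.Propositional using (Unique)
open import Data.Product using (Σ; ∃; _×_; _,_)
open import Data.Sum using (_⊎_)
open import Relation.Binary.PropositionalEquality using (_≡_)
open import Relation.Binary.Construct.Closure.ReflexiveTransitive using (Star)
open import Relation.Nullary using (¬_)

record Universe : Set₁ where
  infix 4 _≤_
  infixl 6 _∨_ _∧_
  field
    Carrier : Set
    _≤_     : Carrier → Carrier → Set
    ≤-refl  : ∀ {x} → x ≤ x
    ≤-trans : ∀ {x y z} → x ≤ y → y ≤ z → x ≤ z
    ≤-antisym : ∀ {x y} → x ≤ y → y ≤ x → x ≡ y
    _*      : Carrier → Carrier
    *-invol : ∀ x → (x *) * ≡ x
    *-rev   : ∀ {x y} → x ≤ y → y * ≤ x *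
    _∨_     : Carrier → Carrier → Carrier
    ∨-ubˡ   : ∀ x y → x ≤ x ∨ y
    ∨-ubʳ   : ∀ x y → y ≤ x ∨ y
    ∨-least : ∀ {x y z} → x ≤ z → y ≤ z → x ∨ y ≤ z
    _∧_     : Carrier → Carrier → Carrier
    ∧-lbˡ   : ∀ x y → x ∧ y ≤ x
    ∧-lbʳ   : ∀ x y → x ∧ y ≤ y
    ∧-greatest : ∀ {x y z} → z ≤ x → z ≤ y → z ≤ x ∧ y

module _ (U : Universe) where
  open Universe U

  _<_ : Carrier → Carrier → Set
  x < y = x ≤ y × ¬ (x ≡ y)

  record SepSys : Set₁ where
    field
      In    : Carrier → Set
      In-*  : ∀ {x} → In x → In (x *)

  Subset : Set₁
  Subset = Carrier → Set

  _⊆_ : Subset → Subset → Set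
  A ⊆ B = ∀ x → A x → B x

  ❴_❵ : Carrier → Subset
  ❴ x ❵ = λ y → y ≡ x

  Degenerate : Carrier → Set
  Degenerate x = x ≡ x *

  module _ (S : SepSys) where
    open SepSys S

    Trivial : Carrier → Set
    Trivial r = ∃ λ s → In s × r < s × r < (s *)

    IsStar : Subset → Set
    IsStar σ = (∃ λ x → σ x) × (∀ x y → σ x → σ y → ¬ (x ≡ y) → x ≤ y *)

    -- a collection of subsets of \vec S; being a *set of sets*, membership
    -- is invariant under extensional equality of subsets
    Family : Set₁
    Family = Subset → Set

    Extensional : Family → Set₁
    Extensional F = ∀ A B → A ⊆ B → B ⊆ A → F A → F B

    SetOfStars : Family → Set₁
    SetOfStars F = ∀ σ → F σ → σ ⊆ In × IsStar σ

    Forces : Family → Carrier → Set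
    Forces F r = F ❴ r * ❵ ⊎ Degenerate r

    Standard : Family → Set
    Standard F = ∀ r → In r → Trivial r → Forces F r

    record Tree : Set₁ where
      field
        n      : ℕ
        Adj    : Fin n → Fin n → Set
        Adj-sym     : ∀ {x y} → Adj x y → Adj y x
        Adj-irrefl  : ∀ {x} → ¬ Adj x x
        connected   : ∀ x y → Star Adj x y
        -- no cycle v0 v1 ... vk (k ≥ 2, distinct vertices)
        acyclic     : ∀ v₀ v₁ v₂ vs →
                      Unique (v₀ ∷ v₁ ∷ v₂ ∷ vs) →
                      Linked Adj (v₀ ∷ v₁ ∷ v₂ ∷ vs) →
                      ∀ v → last (v₂ ∷ vs) ≡ just v → ¬ Adj v v₀
        has-edge    : ∃ λ x → ∃ λ y → Adj x y

    -- S-trees: α is given on all ordered pairs but only its values on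
    -- oriented edges (x , y) with xy ∈ E(T) matter
    record STree : Set₁ where
      field
        tree : Tree
      open Tree tree public
      field
        α     : Fin n → Fin n → Carrier
        α-In  : ∀ {x y} → Adj x y → In (α x y)
        α-*   : ∀ {x y} → Adj x y → α y x ≡ (α x y) *

      Assoc : Fin n → Subset
      Assoc t = λ u → ∃ λ x → Adj x t × α x t ≡ u

      Over : Family → Set
      Over F = ∀ t → F (Assoc t)

      Irredundant : Set
      Irredundant = ∀ t t′ t″ → Adj t′ t → Adj t″ t → ¬ (t′ ≡ t″) →
                    ¬ (α t′ t ≡ α t″ t)

      Leaf : Fin n → Set
      Leaf t = ∃ λ x → Adj x t × (∀ y → Adj y t → y ≡ x)

    -- membership in \vec S_{≥ r} ∖ {←r}
    InDom : Carrier → Carrier → Set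
    InDom r x = In x × (r ≤ x ⊎ r ≤ x *) × ¬ (x ≡ r *)

    -- graph of the shifting map f^{r}_{s₀}:
    --   f(s) = s ∨ s₀ and f(s*) = (s ∨ s₀)* for every s ≥ r in the domain
    --   (i.e. s ∈ \vec S, r ≤ s, s ≠ ←r)
    ShiftGraph : Carrier → Carrier → Carrier → Carrier → Set
    ShiftGraph r s₀ x y =
      (r ≤ x × ¬ (x ≡ r *) × y ≡ x ∨ s₀)
      ⊎ (r ≤ x * × ¬ (x * ≡ r *) × y ≡ (x * ∨ s₀) *)

module Submission where

-- Given x ≤ x′ in the domain, the
-- graph ShiftGraph leaves four cases, according to whether x and x′ are
-- themselves ≥ r ("upward") or are inverses of separations ≥ r ("downward").
--   * both upward:    x ∨ s₀ ≤ x′ ∨ s₀, since ∨ is monotone;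
--   * both downward:  x′* ≤ x*, so x′* ∨ s₀ ≤ x* ∨ s₀, and * reverses this;
--   * x downward, x′ upward:  (x* ∨ s₀)* ≤ x ≤ x′ ≤ x′ ∨ s₀;
--   * x upward, x′ downward:  impossible, since then r ≤ x ≤ x′ and r ≤ x′*,
--     and neither x′ nor x′* equals r (as x′, x′* ≠ r*), so r is trivial.

open import Defs
open import Data.Product using (∃; _×_; _,_)
open import Data.Sum using (inj₁; inj₂)
open import Relation.Binary.PropositionalEquality
  using (_≡_; refl; sym; cong; subst; module ≡-Reasoning)
open import Relation.Nullary using (¬_)
open import Data.Empty using (⊥-elim)

module UniverseFacts (U : Universe) where
  open Universe U

  ∨-monoˡ : ∀ {a b} c → a ≤ b → a ∨ c ≤ b ∨ c
  ∨-monoˡ {a} {b} c a≤b = ∨-least (≤-trans a≤b (∨-ubˡ b c)) (∨-ubʳ b c)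

  dual-join-below : ∀ a c → (a * ∨ c) * ≤ a
  dual-join-below a c = subst ((a * ∨ c) * ≤_) (*-invol a) (*-rev (∨-ubˡ (a *) c))

  dual-join-mono : ∀ {a b} c → a ≤ b → (a * ∨ c) * ≤ (b * ∨ c) *
  dual-join-mono c a≤b = *-rev (∨-monoˡ c (*-rev a≤b))

module SepSysFacts (U : Universe) (S : SepSys U) where
  open Universe U
  open SepSys S

  -- If r lies strictly below both orientations of a separation in S, then r
  -- is trivial; stated for s with s, s* ≠ r*, the form met in the domain of
  -- the shifting map.
  trivial-below-both : ∀ {r s} → In s → r ≤ s → r ≤ s * →
                       ¬ (s ≡ r *) → ¬ (s * ≡ r *) → Trivial U S r
  trivial-below-both {r} {s} s∈S r≤s r≤s* s≢r* s*≢r* =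
    s , s∈S , (r≤s , r≢s) , (r≤s* , r≢s*)
    where
    r≢s : ¬ (r ≡ s)
    r≢s r≡s = s*≢r* (cong _* (sym r≡s))

    r≢s* : ¬ (r ≡ s *)
    r≢s* r≡s* = s≢r* (begin
      s       ≡⟨ sym (*-invol s) ⟩
      (s *) * ≡⟨ cong _* (sym r≡s*) ⟩
      r *     ∎)
      where open ≡-Reasoning

lemma4p1 : (U : Universe) (S : SepSys U) →
    let open Universe U
        open SepSys S
    in (r : Carrier) → In r → ¬ Trivial U S r → ¬ Degenerate U r →
       (∃ λ (F : Family U S) → Extensional U S F × SetOfStars U S F × Standard U S F ×
         ∃ λ (T : STree U S) → STree.Irredundant T × STree.Over T F ×
           ∃ λ t → STree.Leaf T t ×
             (∀ u → (STree.Assoc T t u → u ≡ r *) × (u ≡ r * → STree.Assoc T t u))) →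
       (s₀ : Carrier) → In s₀ → r ≤ s₀ →
       ∀ x x′ → InDom U S r x → InDom U S r x′ → x ≤ x′ →
       ∀ y y′ → ShiftGraph U S r s₀ x y → ShiftGraph U S r s₀ x′ y′ → y ≤ y′
lemma4p1 U S r _ r-nontrivial _ _ s₀ _ _ x x′ _ (x′∈S , _ , x′≢r*) x≤x′ y y′ = monotone
  where
  open Universe U
  open UniverseFacts U
  open SepSysFacts U S

  monotone : ShiftGraph U S r s₀ x y → ShiftGraph U S r s₀ x′ y′ → y ≤ y′
  monotone (inj₁ (_ , _ , refl)) (inj₁ (_ , _ , refl)) = ∨-monoˡ s₀ x≤x′
  monotone (inj₂ (_ , _ , refl)) (inj₂ (_ , _ , refl)) = dual-join-mono s₀ x≤x′
  monotone (inj₂ (_ , _ , refl)) (inj₁ (_ , _ , refl)) =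
    ≤-trans (dual-join-below x s₀) (≤-trans x≤x′ (∨-ubˡ x′ s₀))
  monotone (inj₁ (r≤x , _ , _)) (inj₂ (r≤x′* , x′*≢r* , _)) =
    ⊥-elim (r-nontrivial
      (trivial-below-both x′∈S (≤-trans r≤x x≤x′) r≤x′* x′≢r* x′*≢r*))
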